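{- Suppose that for every integer $n\geq 1$ we have $\mathrm{LP}(n) = \mathrm{LP}^*(n)$, where $\mathrm{LP}^*(3t) = 2t + \frac{t}{3t+1}$, $\mathrm{LP}^*(3t+1) = 2t+1$ and $\mathrm{LP}^*(3t+2) = 2t+1+\frac{2t+1}{3t+2}$ for integers $t \geq 0$. Then $N(n) = \left\lfloor \frac{2n+1}{3}\right\rfloor$ for every integer $n \geq 1$.
   Context: For a positive integer $n$, the triangle of size $n$ is the set of cells $T_n = \{(a,b) : a,b \in \{1,\dots,n\},\ a+b \geq n+1\}$ of an $n\times n$ grid ($a$ = row index from top, $b$ = column index from left). A row is a set of cells of $T_n$ with fixed $a$, a column is a set with fixed $b$, and a standard diagonal is a set of cells of $T_n$ with fixed $a+b$. $N(n)$ denotes the maximum number of dots that can be placed into cells of $T_n$ (at most one per cell) such that each row, each column and each standard diagonal contains at most one dot. $\mathrm{LP}(n)$ denotes the optimal value of the linear program: maximize $\sum_{C\in T_n} x_C$ over real variables $x_C \geq 0$ ($C \in T_n$) subject to the constraints that the sum of the $x_C$ over the cells $C$ of each row, of each column and of each standard diagonal is at most $1$.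
   Formalization: The variables $x_C$ of the linear program defining LP(n) take values in ℚ rather than in ℝ. -}

module Defs where

open import Data.Nat as ℕ using (ℕ; zero; suc; _≤_; _≤ᵇ_; _*_; _+_; _≡ᵇ_)
open import Data.Nat.DivMod using (_/_; _%_)
open import Data.Bool using (Bool; _∧_)
open import Data.Product using (_×_; _,_; proj₁; proj₂; ∃)
open import Data.List using (List; []; _∷_; map; concatMap; filterᵇ; foldr; length)
open import Data.List.Relation.Unary.All using (All)
open import Data.List.Relation.Unary.AllPairs using (AllPairs)
open import Data.List.Membership.Propositional using (_∈_)
open import Data.Integer using (+_)
open import Data.Rational as ℚ using (ℚ; 0ℚ; 1ℚ)
open import Relation.Binary.PropositionalEquality using (_≡_; _≢_)

-- A cell (a , b): a = row index (1..n, from top), b = column index (1..n, from left).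
Cell : Set
Cell = ℕ × ℕ

row col diag : Cell → ℕ
row c = proj₁ c
col c = proj₂ c
diag c = proj₁ c + proj₂ c

range1 : ℕ → List ℕ
range1 zero = []
range1 (suc n) = range1 n Data.List.++ (suc n ∷ [])

InT : ℕ → Cell → Set
InT n (a , b) = (1 ≤ a) × (a ≤ n) × (1 ≤ b) × (b ≤ n) × (suc n ≤ a + b)

cellsT : ℕ → List Cell
cellsT n = filterᵇ (λ c → suc n ≤ᵇ diag c)
             (concatMap (λ a → map (λ b → (a , b)) (range1 n)) (range1 n))

-- A valid placement: a list of cells of T_n, pairwise in different rows,
-- different columns and different standard diagonals (so in particular
-- the cells are distinct, i.e. at most one dot per cell).
ValidPlacement : ℕ → List Cell → Set
ValidPlacement n ds =
  All (InT n) ds ×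
  AllPairs (λ c d → (row c ≢ row d) × (col c ≢ col d) × (diag c ≢ diag d)) ds

IsN : ℕ → ℕ → Set
IsN n k = (∃ λ ds → ValidPlacement n ds × length ds ≡ k)
        × (∀ ds → ValidPlacement n ds → length ds ≤ k)

sumℚ : List ℚ → ℚ
sumℚ = foldr ℚ._+_ 0ℚ

sumOver : ℕ → (Cell → Bool) → (Cell → ℚ) → ℚ
sumOver n p x = sumℚ (map x (filterᵇ p (cellsT n)))

objective : ℕ → (Cell → ℚ) → ℚ
objective n x = sumOver n (λ _ → Bool.true) x
  where import Data.Bool as Bool

Feasible : ℕ → (Cell → ℚ) → Set
Feasible n x =
  (∀ c → c ∈ cellsT n → 0ℚ ℚ.≤ x c) ×
  (∀ a → sumOver n (λ c → row c ≡ᵇ a) x ℚ.≤ 1ℚ) ×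
  (∀ b → sumOver n (λ c → col c ≡ᵇ b) x ℚ.≤ 1ℚ) ×
  (∀ s → sumOver n (λ c → diag c ≡ᵇ s) x ℚ.≤ 1ℚ)

IsLP : ℕ → ℚ → Set
IsLP n v = (∃ λ x → Feasible n x × objective n x ≡ v)
         × (∀ x → Feasible n x → objective n x ℚ.≤ v)

ℕtoℚ : ℕ → ℚ
ℕtoℚ m = (+ m) ℚ./ 1

LPstar' : ℕ → ℕ → ℚ
LPstar' t zero = ℕtoℚ (2 * t) ℚ.+ ((+ t) ℚ./ suc (3 * t))
LPstar' t (suc zero) = ℕtoℚ (2 * t + 1)
LPstar' t (suc (suc _)) = ℕtoℚ (2 * t + 1) ℚ.+ ((+ (2 * t + 1)) ℚ./ suc (3 * t + 1))

LPstar : ℕ → ℚ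
LPstar n = LPstar' (n / 3) (n % 3)

-- Upper bound: the indicator vector of a valid placement is feasible for the LP and its objective is
-- the number of dots, so N(n) ≤ LP*(n); the fractional parts t/(3t+1) and (2t+1)/(3t+2) of LP*(n)
-- are below 1, hence N(n) ≤ ⌊LP*(n)⌋ = ⌊(2n+1)/3⌋.
-- Lower bound: counting heights from the bottom row, the dots at height j+1 in column t+2j+1
-- (j < m) and at height t+j+2 in column t+2j+2 (j < t) occupy distinct rows, columns (by parity)
-- and diagonals. With m = t this places 2t dots for n = 3t, with m = t+1 it places 2t+1 dots
-- for n = 3t+1 and n = 3t+2.
module Submission where

open import Defs
open import Data.Nat using (ℕ; _≤_; _+_; _*_)
open import Data.Nat.DivMod using (_/_)
import Data.Nat.Properties as ℕP
open import Algebra.Properties.CommutativeSemigroup ℕP.+-commutativeSemigroup using (interchange)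
open import Data.Bool using (Bool; true; false)
open import Data.Bool.Properties using (T-≡)
open import Data.Integer as ℤ using (+≤+; +<+)
import Data.Integer.Properties as ℤP
open import Data.List using (List; []; _∷_; _++_; map; concatMap; filterᵇ; length; applyUpTo)
open import Data.List.Properties using (length-map; length-++; length-applyUpTo)
open import Data.List.Relation.Unary.All as All using (All; []; _∷_)
import Data.List.Relation.Unary.All.Properties as All
open import Data.List.Relation.Unary.AllPairs as AllPairs using (AllPairs; []; _∷_)
import Data.List.Relation.Unary.AllPairs.Properties as AllPairs
open import Data.List.Relation.Unary.Unique.Propositional using (Unique)
open import Data.Nat using (zero; suc; _<_; _∸_; _≤ᵇ_; _≡ᵇ_; z≤n; s≤s)
open import Data.Nat.DivMod using (_%_; m≡m%n+[m/n]*n; m%n<n; +-distrib-/-∣ʳ; m*n/n≡m)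
open import Data.Nat.Divisibility using (divides-refl)
open import Data.Nat.Tactic.RingSolver using (solve-∀)
open import Data.Product using (_×_; _,_; proj₁; proj₂)
open import Data.Product.Properties using (≡-dec; ,-injectiveˡ; ,-injectiveʳ)
open import Data.Rational as ℚ using (ℚ; 1ℚ; toℚᵘ; fromℚᵘ)
import Data.Rational.Properties as ℚP
open import Data.Rational.Unnormalised as ℚᵘ using (mkℚᵘ; *≤*; *<*; *≡*)
import Data.Rational.Unnormalised.Properties as ℚᵘP
open import Function using (_∘_; Equivalence)
open import Relation.Binary.Definitions using (DecidableEquality)
open import Relation.Binary.PropositionalEquality
open import Relation.Nullary using (Dec; does; yes; no; contradiction)

private variable
  A B : Set

𝟙 : Bool → ℕ
𝟙 true  = 1
𝟙 false = 0

∑ : List A → (A → ℕ) → ℕ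
∑ []       f = 0
∑ (x ∷ xs) f = f x + ∑ xs f

syntax ∑ xs (λ x → e) = ∑[ x ∈ xs ] e

∑-cong : ∀ xs {f g : A → ℕ} → (∀ x → f x ≡ g x) → ∑ xs f ≡ ∑ xs g
∑-cong []       eq = refl
∑-cong (x ∷ xs) eq = cong₂ _+_ (eq x) (∑-cong xs eq)

∑-cong-All : ∀ {xs} {f g : A → ℕ} → All (λ x → f x ≡ g x) xs → ∑ xs f ≡ ∑ xs g
∑-cong-All []         = refl
∑-cong-All (eq ∷ eqs) = cong₂ _+_ eq (∑-cong-All eqs)

∑-zero : ∀ (xs : List A) → ∑[ x ∈ xs ] 0 ≡ 0
∑-zero []       = refl
∑-zero (x ∷ xs) = ∑-zero xs

∑-one : ∀ (xs : List A) → ∑[ x ∈ xs ] 1 ≡ length xs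
∑-one []       = refl
∑-one (x ∷ xs) = cong suc (∑-one xs)

∑-++ : ∀ xs ys (f : A → ℕ) → ∑ (xs ++ ys) f ≡ ∑ xs f + ∑ ys f
∑-++ []       ys f = refl
∑-++ (x ∷ xs) ys f = trans (cong (f x +_) (∑-++ xs ys f)) (sym (ℕP.+-assoc (f x) _ _))

∑-+ : ∀ xs (f g : A → ℕ) → ∑[ x ∈ xs ] (f x + g x) ≡ ∑ xs f + ∑ xs g
∑-+ []       f g = refl
∑-+ (x ∷ xs) f g = trans (cong (f x + g x +_) (∑-+ xs f g)) (interchange (f x) (g x) _ _)

∑-*ˡ : ∀ c xs (f : A → ℕ) → ∑[ x ∈ xs ] (c * f x) ≡ c * ∑ xs f
∑-*ˡ c []       f = sym (ℕP.*-zeroʳ c)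
∑-*ˡ c (x ∷ xs) f = trans (cong (c * f x +_) (∑-*ˡ c xs f)) (sym (ℕP.*-distribˡ-+ c (f x) _))

∑-*ʳ : ∀ c xs (f : A → ℕ) → ∑[ x ∈ xs ] (f x * c) ≡ ∑ xs f * c
∑-*ʳ c []       f = refl
∑-*ʳ c (x ∷ xs) f = trans (cong (f x * c +_) (∑-*ʳ c xs f)) (sym (ℕP.*-distribʳ-+ c (f x) _))

∑-map : ∀ (h : A → B) xs (f : B → ℕ) → ∑ (map h xs) f ≡ ∑[ x ∈ xs ] f (h x)
∑-map h []       f = refl
∑-map h (x ∷ xs) f = cong (f (h x) +_) (∑-map h xs f)

∑-concatMap : ∀ (h : A → List B) xs (f : B → ℕ) → ∑ (concatMap h xs) f ≡ ∑[ x ∈ xs ] ∑ (h x) f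
∑-concatMap h []       f = refl
∑-concatMap h (x ∷ xs) f =
  trans (∑-++ (h x) (concatMap h xs) f) (cong (∑ (h x) f +_) (∑-concatMap h xs f))

∑-filterᵇ : ∀ (p : A → Bool) xs (f : A → ℕ) → ∑ (filterᵇ p xs) f ≡ ∑[ x ∈ xs ] (𝟙 (p x) * f x)
∑-filterᵇ p []       f = refl
∑-filterᵇ p (x ∷ xs) f with p x
... | true  = cong₂ _+_ (sym (ℕP.*-identityˡ (f x))) (∑-filterᵇ p xs f)
... | false = ∑-filterᵇ p xs f

∑-comm : ∀ xs ys (g : A → B → ℕ) → ∑[ x ∈ xs ] ∑[ y ∈ ys ] g x y ≡ ∑[ y ∈ ys ] ∑[ x ∈ xs ] g x y
∑-comm []       ys g = sym (∑-zero ys)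
∑-comm (x ∷ xs) ys g =
  trans (cong (∑ ys (g x) +_) (∑-comm xs ys g)) (sym (∑-+ ys (g x) (λ y → ∑[ x′ ∈ xs ] g x′ y)))

module Multiplicity {A : Set} (_≟_ : DecidableEquality A) where

  δ : A → A → ℕ
  δ x y = 𝟙 (does (x ≟ y))

  δ-≡ : ∀ {x y} → x ≡ y → δ x y ≡ 1
  δ-≡ {x} {y} x≡y with x ≟ y
  ... | yes _   = refl
  ... | no x≢y = contradiction x≡y x≢y

  δ-≢ : ∀ {x y} → x ≢ y → δ x y ≡ 0
  δ-≢ {x} {y} x≢y with x ≟ y
  ... | yes x≡y = contradiction x≡y x≢y
  ... | no _    = refl

  δ-sym : ∀ x y → δ x y ≡ δ y x
  δ-sym x y with x ≟ y
  ... | yes x≡y = sym (δ-≡ (sym x≡y))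
  ... | no x≢y  = sym (δ-≢ (x≢y ∘ sym))

  *-δ : ∀ (f : A → ℕ) x y → f y * δ x y ≡ f x * δ x y
  *-δ f x y with x ≟ y
  ... | yes refl = refl
  ... | no _     = trans (ℕP.*-zeroʳ (f y)) (sym (ℕP.*-zeroʳ (f x)))

  count : A → List A → ℕ
  count x ys = ∑[ y ∈ ys ] δ x y

  ∑-count-comm : ∀ xs ys → ∑[ x ∈ xs ] count x ys ≡ ∑[ y ∈ ys ] count y xs
  ∑-count-comm xs ys = trans (∑-comm xs ys δ) (∑-cong ys (λ y → ∑-cong xs (λ x → δ-sym x y)))

  count-filterᵇ : ∀ (p : A → Bool) x ys → count x (filterᵇ p ys) ≡ 𝟙 (p x) * count x ys
  count-filterᵇ p x ys = begin
    count x (filterᵇ p ys)           ≡⟨ ∑-filterᵇ p ys (δ x) ⟩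
    ∑[ y ∈ ys ] (𝟙 (p y) * δ x y)    ≡⟨ ∑-cong ys (*-δ (𝟙 ∘ p) x) ⟩
    ∑[ y ∈ ys ] (𝟙 (p x) * δ x y)    ≡⟨ ∑-*ˡ (𝟙 (p x)) ys (δ x) ⟩
    𝟙 (p x) * count x ys             ∎
    where open ≡-Reasoning

  count-absent : ∀ {x ys} → All (x ≢_) ys → count x ys ≡ 0
  count-absent []           = refl
  count-absent (x≢y ∷ x∉ys) = cong₂ _+_ (δ-≢ x≢y) (count-absent x∉ys)

  count-Unique : ∀ x {ys} → Unique ys → count x ys ≤ 1
  count-Unique x {[]}     []           = z≤n
  count-Unique x {y ∷ ys} (y∉ys ∷ !ys) with x ≟ y
  ... | yes refl = s≤s (ℕP.≤-reflexive (count-absent y∉ys))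
  ... | no _     = count-Unique x !ys

  ∑-δ-≤1 : ∀ (f : B → A) a {ds} → AllPairs (λ c d → f c ≢ f d) ds → ∑[ d ∈ ds ] δ (f d) a ≤ 1
  ∑-δ-≤1 f a {ds} f-injective = subst (_≤ 1) fibre (count-Unique a (AllPairs.map⁺ f-injective))
    where
    fibre : count a (map f ds) ≡ ∑[ d ∈ ds ] δ (f d) a
    fibre = trans (∑-map f ds (δ a)) (∑-cong ds (λ d → δ-sym a (f d)))

open Multiplicity using (δ; δ-≡; δ-≢; count)

module _ (_≟ᴬ_ : DecidableEquality A) (_≟ᴮ_ : DecidableEquality B) where

  private
    _≟_ : DecidableEquality (A × B)
    _≟_ = ≡-dec _≟ᴬ_ _≟ᴮ_

  δ-× : ∀ a a′ b b′ → δ _≟_ (a , b) (a′ , b′) ≡ δ _≟ᴬ_ a a′ * δ _≟ᴮ_ b b′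
  δ-× a a′ b b′ = by-cases (a ≟ᴬ a′) (b ≟ᴮ b′)
    where
    by-cases : Dec (a ≡ a′) → Dec (b ≡ b′) → δ _≟_ (a , b) (a′ , b′) ≡ δ _≟ᴬ_ a a′ * δ _≟ᴮ_ b b′
    by-cases (yes a≡a′) (yes b≡b′) =
      trans (δ-≡ _≟_ (cong₂ _,_ a≡a′ b≡b′)) (sym (cong₂ _*_ (δ-≡ _≟ᴬ_ a≡a′) (δ-≡ _≟ᴮ_ b≡b′)))
    by-cases (no a≢a′) _ =
      trans (δ-≢ _≟_ (a≢a′ ∘ ,-injectiveˡ)) (sym (cong (_* _) (δ-≢ _≟ᴬ_ a≢a′)))
    by-cases (yes _) (no b≢b′) =
      trans (δ-≢ _≟_ (b≢b′ ∘ ,-injectiveʳ))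
            (sym (trans (cong (δ _≟ᴬ_ a a′ *_) (δ-≢ _≟ᴮ_ b≢b′)) (ℕP.*-zeroʳ (δ _≟ᴬ_ a a′))))

  count-grid : ∀ a b (as : List A) (bs : List B) →
               count _≟_ (a , b) (concatMap (λ a′ → map (a′ ,_) bs) as) ≡ count _≟ᴬ_ a as * count _≟ᴮ_ b bs
  count-grid a b as bs = begin
    count _≟_ (a , b) (concatMap (λ a′ → map (a′ ,_) bs) as)
      ≡⟨ ∑-concatMap (λ a′ → map (a′ ,_) bs) as (δ _≟_ (a , b)) ⟩
    ∑[ a′ ∈ as ] count _≟_ (a , b) (map (a′ ,_) bs)
      ≡⟨ ∑-cong as (λ a′ → trans (∑-map (a′ ,_) bs (δ _≟_ (a , b))) (∑-cong bs (δ-× a a′ b))) ⟩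
    ∑[ a′ ∈ as ] ∑[ b′ ∈ bs ] (δ _≟ᴬ_ a a′ * δ _≟ᴮ_ b b′)
      ≡⟨ ∑-cong as (λ a′ → ∑-*ˡ (δ _≟ᴬ_ a a′) bs (δ _≟ᴮ_ b)) ⟩
    ∑[ a′ ∈ as ] (δ _≟ᴬ_ a a′ * count _≟ᴮ_ b bs)
      ≡⟨ ∑-*ʳ (count _≟ᴮ_ b bs) as (δ _≟ᴬ_ a) ⟩
    count _≟ᴬ_ a as * count _≟ᴮ_ b bs
      ∎
    where open ≡-Reasoning

count-range1-suc : ∀ x n → count ℕP._≟_ x (range1 (suc n)) ≡ count ℕP._≟_ x (range1 n) + δ ℕP._≟_ x (suc n)
count-range1-suc x n =
  trans (∑-++ (range1 n) (suc n ∷ []) (δ ℕP._≟_ x)) (cong (count ℕP._≟_ x (range1 n) +_) (ℕP.+-identityʳ _))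

count-range1-above : ∀ {x} n → n < x → count ℕP._≟_ x (range1 n) ≡ 0
count-range1-above         zero    n<x = refl
count-range1-above {x} (suc n) n<x =
  trans (count-range1-suc x n)
        (cong₂ _+_ (count-range1-above n (ℕP.<-trans (ℕP.n<1+n n) n<x)) (δ-≢ ℕP._≟_ (ℕP.<⇒≢ n<x ∘ sym)))

count-range1 : ∀ {x} n → 1 ≤ x → x ≤ n → count ℕP._≟_ x (range1 n) ≡ 1
count-range1 zero 1≤x x≤0 = contradiction (ℕP.≤-trans 1≤x x≤0) ℕP.1+n≰n
count-range1 {x} (suc n) 1≤x x≤1+n with x ℕP.≟ suc n
... | yes refl =
  trans (count-range1-suc x n) (cong₂ _+_ (count-range1-above n ℕP.≤-refl) (δ-≡ ℕP._≟_ {x} refl))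
... | no x≢1+n =
  trans (count-range1-suc x n)
        (cong₂ _+_ (count-range1 n 1≤x (ℕP.≤-pred (ℕP.≤∧≢⇒< x≤1+n x≢1+n))) (δ-≢ ℕP._≟_ x≢1+n))

_≟ᶜ_ : DecidableEquality Cell
_≟ᶜ_ = ≡-dec ℕP._≟_ ℕP._≟_

count-cellsT : ∀ {n c} → InT n c → count _≟ᶜ_ c (cellsT n) ≡ 1
count-cellsT {n} {a , b} (1≤a , a≤n , 1≤b , b≤n , n<a+b) = begin
  count _≟ᶜ_ (a , b) (cellsT n)
    ≡⟨ Multiplicity.count-filterᵇ _≟ᶜ_ (λ c → suc n ≤ᵇ diag c) (a , b) grid ⟩
  𝟙 (suc n ≤ᵇ (a + b)) * count _≟ᶜ_ (a , b) grid
    ≡⟨ cong (λ β → 𝟙 β * count _≟ᶜ_ (a , b) grid) (Equivalence.to T-≡ (ℕP.≤⇒≤ᵇ n<a+b)) ⟩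
  1 * count _≟ᶜ_ (a , b) grid
    ≡⟨ ℕP.*-identityˡ _ ⟩
  count _≟ᶜ_ (a , b) grid
    ≡⟨ count-grid ℕP._≟_ ℕP._≟_ a b (range1 n) (range1 n) ⟩
  count ℕP._≟_ a (range1 n) * count ℕP._≟_ b (range1 n)
    ≡⟨ cong₂ _*_ (count-range1 n 1≤a a≤n) (count-range1 n 1≤b b≤n) ⟩
  1 ∎
  where
  open ≡-Reasoning
  grid : List Cell
  grid = concatMap (λ a′ → map (a′ ,_) (range1 n)) (range1 n)

-- ℕtoℚ m and (+ b) ℚ./ suc d reduce to fromℚᵘ (mkℚᵘ (+ m) 0) and fromℚᵘ (mkℚᵘ (+ b) d),
-- so their order properties are transported from ℚᵘ, where they are integer inequalities.
fromℚᵘ-mono-≤ : ∀ {p q} → p ℚᵘ.≤ q → fromℚᵘ p ℚ.≤ fromℚᵘ q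
fromℚᵘ-mono-≤ {p} {q} p≤q = ℚP.toℚᵘ-cancel-≤
  (ℚᵘP.≤-respˡ-≃ (ℚᵘP.≃-sym (ℚP.toℚᵘ-fromℚᵘ p)) (ℚᵘP.≤-respʳ-≃ (ℚᵘP.≃-sym (ℚP.toℚᵘ-fromℚᵘ q)) p≤q))

fromℚᵘ-mono-< : ∀ {p q} → p ℚᵘ.< q → fromℚᵘ p ℚ.< fromℚᵘ q
fromℚᵘ-mono-< {p} {q} p<q = ℚP.toℚᵘ-cancel-<
  (ℚᵘP.<-respˡ-≃ (ℚᵘP.≃-sym (ℚP.toℚᵘ-fromℚᵘ p)) (ℚᵘP.<-respʳ-≃ (ℚᵘP.≃-sym (ℚP.toℚᵘ-fromℚᵘ q)) p<q))

fromℚᵘ-cancel-< : ∀ {p q} → fromℚᵘ p ℚ.< fromℚᵘ q → p ℚᵘ.< q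
fromℚᵘ-cancel-< {p} {q} p<q =
  ℚᵘP.<-respˡ-≃ (ℚP.toℚᵘ-fromℚᵘ p) (ℚᵘP.<-respʳ-≃ (ℚP.toℚᵘ-fromℚᵘ q) (ℚP.toℚᵘ-mono-< p<q))

ℕtoℚ-homo-+ : ∀ m n → ℕtoℚ (m + n) ≡ ℕtoℚ m ℚ.+ ℕtoℚ n
ℕtoℚ-homo-+ m n = ℚP.toℚᵘ-injective (begin
  toℚᵘ (ℕtoℚ (m + n))                ≈⟨ ℚP.toℚᵘ-fromℚᵘ (mkℚᵘ (ℤ.+ (m + n)) 0) ⟩
  mkℚᵘ (ℤ.+ (m + n)) 0                ≈⟨ integer-sum ⟩
  mkℚᵘ (ℤ.+ m) 0 ℚᵘ.+ mkℚᵘ (ℤ.+ n) 0  ≈⟨ ℚᵘP.+-cong (ℚP.toℚᵘ-fromℚᵘ (mkℚᵘ (ℤ.+ m) 0))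
                                                     (ℚP.toℚᵘ-fromℚᵘ (mkℚᵘ (ℤ.+ n) 0)) ⟨
  toℚᵘ (ℕtoℚ m) ℚᵘ.+ toℚᵘ (ℕtoℚ n)    ≈⟨ ℚP.toℚᵘ-homo-+ (ℕtoℚ m) (ℕtoℚ n) ⟨
  toℚᵘ (ℕtoℚ m ℚ.+ ℕtoℚ n)            ∎)
  where
  open import Relation.Binary.Reasoning.Setoid ℚᵘP.≃-setoid
  integer-sum : mkℚᵘ (ℤ.+ (m + n)) 0 ℚᵘ.≃ mkℚᵘ (ℤ.+ m) 0 ℚᵘ.+ mkℚᵘ (ℤ.+ n) 0
  integer-sum = *≡* (trans (ℤP.*-identityʳ (ℤ.+ (m + n)))
                  (sym (trans (ℤP.*-identityʳ (ℤ.+ m ℤ.* ℤ.+ 1 ℤ.+ ℤ.+ n ℤ.* ℤ.+ 1))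
                  (cong₂ ℤ._+_ (ℤP.*-identityʳ (ℤ.+ m)) (ℤP.*-identityʳ (ℤ.+ n))))))

ℕtoℚ-mono-≤ : ∀ {m n} → m ≤ n → ℕtoℚ m ℚ.≤ ℕtoℚ n
ℕtoℚ-mono-≤ {m} {n} m≤n =
  fromℚᵘ-mono-≤ {mkℚᵘ (ℤ.+ m) 0} {mkℚᵘ (ℤ.+ n) 0}
    (*≤* (subst₂ ℤ._≤_ (sym (ℤP.*-identityʳ (ℤ.+ m))) (sym (ℤP.*-identityʳ (ℤ.+ n))) (+≤+ m≤n)))

ℕtoℚ-cancel-< : ∀ {m n} → ℕtoℚ m ℚ.< ℕtoℚ n → m < n
ℕtoℚ-cancel-< {m} {n} m<n with fromℚᵘ-cancel-< {mkℚᵘ (ℤ.+ m) 0} {mkℚᵘ (ℤ.+ n) 0} m<n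
... | *<* m*1<n*1 = ℤP.drop‿+<+ (subst₂ ℤ._<_ (ℤP.*-identityʳ (ℤ.+ m)) (ℤP.*-identityʳ (ℤ.+ n)) m*1<n*1)

fraction<1 : ∀ {b} d → b < suc d → (ℤ.+ b) ℚ./ suc d ℚ.< 1ℚ
fraction<1 {b} d b<1+d =
  fromℚᵘ-mono-< {mkℚᵘ (ℤ.+ b) d} {mkℚᵘ (ℤ.+ 1) 0}
    (*<* (subst₂ ℤ._<_ (sym (ℤP.*-identityʳ (ℤ.+ b))) (sym (ℤP.*-identityˡ (ℤ.+ suc d))) (+<+ b<1+d)))

ℕtoℚ-floor : ∀ {L A q} → ℕtoℚ L ℚ.≤ ℕtoℚ A ℚ.+ q → q ℚ.< 1ℚ → L ≤ A
ℕtoℚ-floor {L} {A} {q} L≤A+q q<1 = ℕP.m<1+n⇒m≤n (subst (L <_) (ℕP.+-comm A 1) (ℕtoℚ-cancel-< L<A+1))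
  where
  L<A+1 : ℕtoℚ L ℚ.< ℕtoℚ (A + 1)
  L<A+1 = ℚP.≤-<-trans L≤A+q
            (subst (ℕtoℚ A ℚ.+ q ℚ.<_) (sym (ℕtoℚ-homo-+ A 1)) (ℚP.+-monoʳ-< (ℕtoℚ A) q<1))

ℕtoℚ-cancel-≤ : ∀ {m n} → ℕtoℚ m ℚ.≤ ℕtoℚ n → m ≤ n
ℕtoℚ-cancel-≤ {m} {n} m≤n =
  ℕtoℚ-floor (subst (ℕtoℚ m ℚ.≤_) (sym (ℚP.+-identityʳ (ℕtoℚ n))) m≤n) (fraction<1 0 (s≤s z≤n))

sumℚ-ℕtoℚ : ∀ xs (f : A → ℕ) → sumℚ (map (λ x → ℕtoℚ (f x)) xs) ≡ ℕtoℚ (∑ xs f)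
sumℚ-ℕtoℚ []       f = refl
sumℚ-ℕtoℚ (x ∷ xs) f = trans (cong (ℕtoℚ (f x) ℚ.+_) (sumℚ-ℕtoℚ xs f)) (sym (ℕtoℚ-homo-+ (f x) _))

dotsOf : List Cell → Cell → ℚ
dotsOf ds c = ℕtoℚ (count _≟ᶜ_ c ds)

sumOver-dotsOf : ∀ n p {ds} → All (InT n) ds → sumOver n p (dotsOf ds) ≡ ℕtoℚ (∑[ d ∈ ds ] 𝟙 (p d))
sumOver-dotsOf n p {ds} ds⊆T = begin
  sumOver n p (dotsOf ds)                          ≡⟨ sumℚ-ℕtoℚ line (λ c → count _≟ᶜ_ c ds) ⟩
  ℕtoℚ (∑[ c ∈ line ] count _≟ᶜ_ c ds)             ≡⟨ cong ℕtoℚ (Multiplicity.∑-count-comm _≟ᶜ_ line ds) ⟩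
  ℕtoℚ (∑[ d ∈ ds ] count _≟ᶜ_ d line)             ≡⟨ cong ℕtoℚ (∑-cong-All (All.map count-line ds⊆T)) ⟩
  ℕtoℚ (∑[ d ∈ ds ] 𝟙 (p d))                       ∎
  where
  open ≡-Reasoning
  line : List Cell
  line = filterᵇ p (cellsT n)
  count-line : ∀ {d} → InT n d → count _≟ᶜ_ d line ≡ 𝟙 (p d)
  count-line {d} d∈T = trans (Multiplicity.count-filterᵇ _≟ᶜ_ p d (cellsT n))
                             (trans (cong (𝟙 (p d) *_) (count-cellsT d∈T)) (ℕP.*-identityʳ (𝟙 (p d))))

sumOver-line-≤1 : ∀ n (f : Cell → ℕ) a {ds} → All (InT n) ds → AllPairs (λ c d → f c ≢ f d) ds →
                  sumOver n (λ c → f c ≡ᵇ a) (dotsOf ds) ℚ.≤ 1ℚ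
sumOver-line-≤1 n f a ds⊆T f-injective =
  subst (ℚ._≤ 1ℚ) (sym (sumOver-dotsOf n _ ds⊆T)) (ℕtoℚ-mono-≤ (Multiplicity.∑-δ-≤1 ℕP._≟_ f a f-injective))

placement-feasible : ∀ {n ds} → ValidPlacement n ds → Feasible n (dotsOf ds)
placement-feasible {n} {ds} (ds⊆T , separated) =
  (λ c _ → ℕtoℚ-mono-≤ {0} {count _≟ᶜ_ c ds} z≤n) ,
  (λ a → sumOver-line-≤1 n row a ds⊆T (AllPairs.map proj₁ separated)) ,
  (λ b → sumOver-line-≤1 n col b ds⊆T (AllPairs.map (proj₁ ∘ proj₂) separated)) ,
  (λ s → sumOver-line-≤1 n diag s ds⊆T (AllPairs.map (proj₂ ∘ proj₂) separated))

placement≤LP : ∀ {n v ds} → IsLP n v → ValidPlacement n ds → ℕtoℚ (length ds) ℚ.≤ v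
placement≤LP {n} {v} {ds} (_ , optimal) valid@(ds⊆T , _) =
  subst (ℚ._≤ v) objective-value (optimal (dotsOf ds) (placement-feasible valid))
  where
  objective-value : objective n (dotsOf ds) ≡ ℕtoℚ (length ds)
  objective-value = trans (sumOver-dotsOf n _ ds⊆T) (cong ℕtoℚ (∑-one ds))

AllPairs-map⁺-All : ∀ {P : A → Set} {R : A → A → Set} {S : B → B → Set} (f : A → B) →
                    (∀ {x y} → P x → P y → R x y → S (f x) (f y)) →
                    ∀ {xs} → All P xs → AllPairs R xs → AllPairs S (map f xs)
AllPairs-map⁺-All f preserves []         []           = []
AllPairs-map⁺-All f preserves (px ∷ pxs) (rx ∷ rxs) =
  All.map⁺ (All.zipWith (λ (py , r) → preserves px py r) (pxs , rx)) ∷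
  AllPairs-map⁺-All f preserves pxs rxs

-- A pair (i , d) stands for the dot at height i (the bottom row of T_n has height 1) on the
-- diagonal a + b = n + 1 + d; it lies in column i + d.
fromBottom : ℕ → ℕ × ℕ → Cell
fromBottom n (i , d) = (suc n ∸ i , i + d)

Fits : ℕ → ℕ × ℕ → Set
Fits n (i , d) = 1 ≤ i × i + d ≤ n

Apart : ℕ × ℕ → ℕ × ℕ → Set
Apart (i , d) (i′ , d′) = i ≢ i′ × i + d ≢ i′ + d′ × d ≢ d′

Separated : Cell → Cell → Set
Separated c c′ = row c ≢ row c′ × col c ≢ col c′ × diag c ≢ diag c′

height≤ : ∀ {n i d} → Fits n (i , d) → i ≤ suc n
height≤ {i = i} {d} (_ , i+d≤n) = ℕP.m≤n⇒m≤1+n (ℕP.≤-trans (ℕP.m≤m+n i d) i+d≤n)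

diag-fromBottom : ∀ n {i} d → i ≤ suc n → diag (fromBottom n (i , d)) ≡ suc n + d
diag-fromBottom n {i} d i≤1+n =
  trans (sym (ℕP.+-assoc (suc n ∸ i) i d)) (cong (_+ d) (ℕP.m∸n+n≡m i≤1+n))

fromBottom-InT : ∀ {n p} → Fits n p → InT n (fromBottom n p)
fromBottom-InT {n} {i , d} fits@(1≤i , i+d≤n) =
  ℕP.m<n⇒0<n∸m (ℕP.≤-trans (s≤s (ℕP.m≤m+n i d)) (s≤s i+d≤n)) ,
  ℕP.∸-monoʳ-≤ (suc n) 1≤i ,
  ℕP.≤-trans 1≤i (ℕP.m≤m+n i d) ,
  i+d≤n ,
  subst (suc n ≤_) (sym (diag-fromBottom n d (height≤ fits))) (ℕP.m≤m+n (suc n) d)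

fromBottom-separated : ∀ {n p q} → Fits n p → Fits n q → Apart p q →
                       Separated (fromBottom n p) (fromBottom n q)
fromBottom-separated {n} {i , d} {i′ , d′} fits fits′ (i≢i′ , c≢c′ , d≢d′) =
  i≢i′ ∘ ℕP.∸-cancelˡ-≡ (height≤ fits) (height≤ fits′) ,
  c≢c′ ,
  λ eq → d≢d′ (ℕP.+-cancelˡ-≡ (suc n) d d′
            (trans (sym (diag-fromBottom n d (height≤ fits)))
                   (trans eq (diag-fromBottom n d′ (height≤ fits′)))))

fromBottom-valid : ∀ {n ps} → All (Fits n) ps → AllPairs Apart ps → ValidPlacement n (map (fromBottom n) ps)
fromBottom-valid {n} fits apart =
  All.map⁺ (All.map fromBottom-InT fits) , AllPairs-map⁺-All (fromBottom n) fromBottom-separated fits apart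

lowerDot upperDot : ℕ → ℕ → ℕ × ℕ
lowerDot t j = (suc j , t + j)
upperDot t j = (suc (suc (t + j)) , j)

lowerDot-column : ∀ t j → suc (suc j + (t + j)) ≡ t + 2 * suc j
lowerDot-column = solve-∀

upperDot-column : ∀ t j → suc (suc (t + j)) + j ≡ t + 2 * suc j
upperDot-column = solve-∀

lowerDots-apart : ∀ t {j j′} → j ≢ j′ → Apart (lowerDot t j) (lowerDot t j′)
lowerDots-apart t {j} {j′} j≢j′ =
  j≢j′ ∘ ℕP.suc-injective ,
  (λ eq → j≢j′ (ℕP.suc-injective (ℕP.*-cancelˡ-≡ (suc j) (suc j′) 2 (ℕP.+-cancelˡ-≡ t _ _
    (trans (sym (lowerDot-column t j)) (trans (cong suc eq) (lowerDot-column t j′))))))) ,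
  j≢j′ ∘ ℕP.+-cancelˡ-≡ t j j′

upperDots-apart : ∀ t {j j′} → j ≢ j′ → Apart (upperDot t j) (upperDot t j′)
upperDots-apart t {j} {j′} j≢j′ =
  j≢j′ ∘ ℕP.+-cancelˡ-≡ t j j′ ∘ ℕP.suc-injective ∘ ℕP.suc-injective ,
  (λ eq → j≢j′ (ℕP.suc-injective (ℕP.*-cancelˡ-≡ (suc j) (suc j′) 2 (ℕP.+-cancelˡ-≡ t _ _
    (trans (sym (upperDot-column t j)) (trans eq (upperDot-column t j′))))))) ,
  j≢j′

lower-upper-apart : ∀ t {j j′} → j ≤ t → j′ < t → Apart (lowerDot t j) (upperDot t j′)
lower-upper-apart t {j} {j′} j≤t j′<t =
  ℕP.<⇒≢ (s≤s (ℕP.≤-trans j≤t (ℕP.m≤m+n t j′))) ∘ ℕP.suc-injective ,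
  (λ eq → ℕP.even≢odd (suc j) (suc j′) (ℕP.+-cancelˡ-≡ t _ _ (begin
     t + 2 * suc j                 ≡⟨ lowerDot-column t j ⟨
     suc (suc j + (t + j))         ≡⟨ cong suc eq ⟩
     suc (suc (suc (t + j′)) + j′)  ≡⟨ cong suc (upperDot-column t j′) ⟩
     suc (t + 2 * suc j′)          ≡⟨ ℕP.+-suc t (2 * suc j′) ⟨
     t + suc (2 * suc j′)          ∎))) ,
  ℕP.<⇒≢ (ℕP.<-≤-trans j′<t (ℕP.m≤m+n t j)) ∘ sym
  where open ≡-Reasoning

layout : ℕ → ℕ → List (ℕ × ℕ)
layout t m = applyUpTo (lowerDot t) m ++ applyUpTo (upperDot t) t

layout-length : ∀ t m → length (layout t m) ≡ m + t
layout-length t m = trans (length-++ (applyUpTo (lowerDot t) m))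
                          (cong₂ _+_ (length-applyUpTo (lowerDot t) m) (length-applyUpTo (upperDot t) t))

layout-apart : ∀ t {m} → m ≤ suc t → AllPairs Apart (layout t m)
layout-apart t {m} m≤1+t = AllPairs.++⁺
  (AllPairs.applyUpTo⁺₁ (lowerDot t) m (λ j<j′ _ → lowerDots-apart t (ℕP.<⇒≢ j<j′)))
  (AllPairs.applyUpTo⁺₁ (upperDot t) t (λ j<j′ _ → upperDots-apart t (ℕP.<⇒≢ j<j′)))
  (All.applyUpTo⁺₁ (lowerDot t) m λ j<m →
     All.applyUpTo⁺₁ (upperDot t) t (lower-upper-apart t (ℕP.≤-pred (ℕP.≤-trans j<m m≤1+t))))

layout-fits : ∀ {n} t {m} → t + 2 * t ≤ n → t + 2 * m ≤ suc n → All (Fits n) (layout t m)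
layout-fits {n} t {m} 3t≤n t+2m≤1+n = All.++⁺
  (All.applyUpTo⁺₁ (lowerDot t) m λ {j} j<m → s≤s z≤n ,
     ℕP.≤-pred (subst (_≤ suc n) (sym (lowerDot-column t j))
       (ℕP.≤-trans (ℕP.+-monoʳ-≤ t (ℕP.*-monoʳ-≤ 2 j<m)) t+2m≤1+n)))
  (All.applyUpTo⁺₁ (upperDot t) t λ {j} j<t → s≤s z≤n ,
     subst (_≤ n) (sym (upperDot-column t j)) (ℕP.≤-trans (ℕP.+-monoʳ-≤ t (ℕP.*-monoʳ-≤ 2 j<t)) 3t≤n))

isN-from-layout : ∀ {n k v} ps → All (Fits n) ps → AllPairs Apart ps → length ps ≡ k →
                  IsLP n v → (∀ {L} → ℕtoℚ L ℚ.≤ v → L ≤ k) → IsN n k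
isN-from-layout {n} ps fits apart length≡k lp lp-floor =
  (map (fromBottom n) ps , fromBottom-valid fits apart , trans (length-map (fromBottom n) ps) length≡k) ,
  λ ds valid → lp-floor (placement≤LP lp valid)

[2[r+t*3]+1]/3≡2t+[2r+1]/3 : ∀ r t → (2 * (r + t * 3) + 1) / 3 ≡ 2 * t + (2 * r + 1) / 3
[2[r+t*3]+1]/3≡2t+[2r+1]/3 r t = begin
  (2 * (r + t * 3) + 1) / 3        ≡⟨ cong (_/ 3) (regroup r t) ⟩
  ((2 * r + 1) + 2 * t * 3) / 3    ≡⟨ +-distrib-/-∣ʳ (2 * r + 1) (divides-refl (2 * t)) ⟩
  (2 * r + 1) / 3 + 2 * t * 3 / 3  ≡⟨ cong ((2 * r + 1) / 3 +_) (m*n/n≡m (2 * t) 3) ⟩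
  (2 * r + 1) / 3 + 2 * t          ≡⟨ ℕP.+-comm ((2 * r + 1) / 3) (2 * t) ⟩
  2 * t + (2 * r + 1) / 3          ∎
  where
  open ≡-Reasoning
  regroup : ∀ r t → 2 * (r + t * 3) + 1 ≡ (2 * r + 1) + 2 * t * 3
  regroup = solve-∀

t+2t≡t*3 : ∀ t → t + 2 * t ≡ t * 3
t+2t≡t*3 = solve-∀

t+t≡2t+0 : ∀ t → t + t ≡ 2 * t + 0
t+t≡2t+0 = solve-∀

t+2[1+t]≡2+t*3 : ∀ t → t + 2 * suc t ≡ 2 + t * 3
t+2[1+t]≡2+t*3 = solve-∀

[1+t]+t≡2t+1 : ∀ t → suc t + t ≡ 2 * t + 1
[1+t]+t≡2t+1 = solve-∀

N-from-LPstar : ∀ {n} t r → n ≡ r + t * 3 → r < 3 → IsLP n (LPstar' t r) → IsN n ((2 * n + 1) / 3)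
N-from-LPstar t 0 refl _ lp rewrite [2[r+t*3]+1]/3≡2t+[2r+1]/3 0 t =
  isN-from-layout (layout t t)
    (layout-fits t (ℕP.≤-reflexive (t+2t≡t*3 t)) (ℕP.m≤n⇒m≤1+n (ℕP.≤-reflexive (t+2t≡t*3 t))))
    (layout-apart t (ℕP.n≤1+n t)) (trans (layout-length t t) (t+t≡2t+0 t)) lp
    (λ L≤ → ℕP.m≤n⇒m≤n+o 0 (ℕtoℚ-floor L≤ (fraction<1 (3 * t) (s≤s (ℕP.m≤n*m t 3)))))
N-from-LPstar t 1 refl _ lp rewrite [2[r+t*3]+1]/3≡2t+[2r+1]/3 1 t =
  isN-from-layout (layout t (suc t))
    (layout-fits t (ℕP.m≤n⇒m≤1+n (ℕP.≤-reflexive (t+2t≡t*3 t))) (ℕP.≤-reflexive (t+2[1+t]≡2+t*3 t)))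
    (layout-apart t ℕP.≤-refl) (trans (layout-length t (suc t)) ([1+t]+t≡2t+1 t)) lp
    ℕtoℚ-cancel-≤
N-from-LPstar t 2 refl _ lp rewrite [2[r+t*3]+1]/3≡2t+[2r+1]/3 2 t =
  isN-from-layout (layout t (suc t))
    (layout-fits t (ℕP.m≤n⇒m≤o+n 2 (ℕP.≤-reflexive (t+2t≡t*3 t)))
                   (ℕP.m≤n⇒m≤1+n (ℕP.≤-reflexive (t+2[1+t]≡2+t*3 t))))
    (layout-apart t ℕP.≤-refl) (trans (layout-length t (suc t)) ([1+t]+t≡2t+1 t)) lp
    (λ L≤ → ℕtoℚ-floor L≤
               (fraction<1 (3 * t + 1) (s≤s (ℕP.+-monoˡ-≤ 1 (ℕP.*-monoˡ-≤ t {2} {3} (s≤s (s≤s z≤n)))))))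
N-from-LPstar t (suc (suc (suc r))) _ (s≤s (s≤s (s≤s ())))

theorem3 : (∀ n → 1 ≤ n → IsLP n (LPstar n)) →
           ∀ n → 1 ≤ n → IsN n ((2 * n + 1) / 3)
theorem3 LP≡LP* n 1≤n = N-from-LPstar (n / 3) (n % 3) (m≡m%n+[m/n]*n n 3) (m%n<n n 3) (LP≡LP* n 1≤n)
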